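{- Let $n\geq 2$ and consider any draw for the two-division tournament described in the context. In total there are at most $n$ common fixtures in rounds $1$ and $2n$ combined. Similarly, in total there are at most $n$ common fixtures in rounds $2$ and $2n+1$ combined.
   Context: There are $2n+2$ clubs labelled $0,1,\ldots,2n+1$. Clubs $0,\ldots,2n-1$ each have one team in division one and one in division two; clubs $2n$ and $2n+1$ have a team in division two only. In a round robin every pair of teams plays exactly once, organised into rounds in which every team plays exactly one match. Division one is a double round robin over rounds $1,\ldots,4n-2$, where rounds $1,\ldots,2n-1$ form a single round robin among its $2n$ teams and for $r=1,\ldots,2n-1$ round $r+(2n-1)$ has exactly the same matches as round $r$. Division two is a single round robin among its $2n+2$ teams played in rounds $1,\ldots,2n+1$. Two clubs $x,y\in\{0,\ldots,2n-1\}$ have a common fixture in round $r$ if their division-one teams and their division-two teams both play each other in round $r$. -}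

module Defs where

open import Data.Nat using (ℕ; _+_; _*_; _∸_; _≤_)
open import Data.Fin using (Fin; _↑ˡ_; _<?_; _<_)
open import Data.Fin.Properties using (_≟_)
open import Data.List using (List; length; filter; allFin)
open import Data.Product using (Σ; _×_)
open import Relation.Binary.PropositionalEquality using (_≡_; _≢_)
open import Relation.Nullary using (Dec; yes; no)
open import Relation.Nullary.Decidable using (_×-dec_)

-- A schedule for m teams: round r (a natural number, rounds are 1-based)
-- assigns to each team its opponent.
Schedule : ℕ → Set
Schedule m = ℕ → Fin m → Fin m

IsRound : {m : ℕ} → (Fin m → Fin m) → Set
IsRound {m} f = (∀ x → f x ≢ x) × (∀ x → f (f x) ≡ x)

SingleRoundRobin : (m R : ℕ) → Schedule m → Set
SingleRoundRobin m R s =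
  (∀ r → 1 ≤ r → r ≤ R → IsRound (s r)) ×
  (∀ (x y : Fin m) → x ≢ y →
     Σ ℕ λ r → 1 ≤ r × r ≤ R × s r x ≡ y ×
       (∀ r' → 1 ≤ r' → r' ≤ R → s r' x ≡ y → r' ≡ r))

-- Division one (clubs 0..2n-1): double round robin over rounds 1..4n-2,
-- rounds 1..2n-1 a single round robin, round r+(2n-1) identical to round r.
DivisionOne : (n : ℕ) → Schedule (2 * n) → Set
DivisionOne n d1 =
  SingleRoundRobin (2 * n) (2 * n ∸ 1) d1 ×
  (∀ r → 1 ≤ r → r ≤ 2 * n ∸ 1 → ∀ x → d1 (r + (2 * n ∸ 1)) x ≡ d1 r x)

DivisionTwo : (n : ℕ) → Schedule (2 * n + 2) → Set
DivisionTwo n d2 = SingleRoundRobin (2 * n + 2) (2 * n + 1) d2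

-- The division-two team of club x ∈ {0..2n-1} (same label x).
team₂ : (n : ℕ) → Fin (2 * n) → Fin (2 * n + 2)
team₂ n x = x ↑ˡ 2

CommonFixture : (n : ℕ) → Schedule (2 * n) → Schedule (2 * n + 2) →
                ℕ → Fin (2 * n) → Fin (2 * n) → Set
CommonFixture n d1 d2 r x y = (d1 r x ≡ y) × (d2 r (team₂ n x) ≡ team₂ n y)

-- Number of common fixtures in round r: the number of unordered pairs
-- {x,y} (counted once, via x < y) with a common fixture in round r.
commonFixtures : (n : ℕ) → Schedule (2 * n) → Schedule (2 * n + 2) → ℕ → ℕ
commonFixtures n d1 d2 r =
  length (filter (λ x → (x <? d1 r x) ×-dec (d2 r (team₂ n x) ≟ team₂ n (d1 r x)))
                 (allFin (2 * n)))

module Submission where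

-- Division one repeats round r in round r + (2n-1), so rounds 1 and 2n,
-- and likewise rounds 2 and 2n+1, carry the same division-one pairing f.  A pair
-- {x, f x} with a common fixture in both rounds would meet twice in the division-two
-- single round robin, which is impossible because both rounds lie among its rounds
-- 1..2n+1.  So the pairs counted in the two rounds are disjoint sets of pairs of f,
-- and f has at most n pairs.

open import Defs
open import Data.Nat using (ℕ; suc; _+_; _*_; _∸_; _≤_; z≤n; s≤s)
open import Data.Nat.Properties
  using (≤-trans; +-monoʳ-≤; +-monoˡ-≤; +-identityʳ; +-comm; *-monoʳ-≤; *-cancelˡ-≤;
         ∸-monoˡ-≤; m≤m+n; m<m+n; <⇒≢; m+[n∸m]≡n; module ≤-Reasoning)
open import Data.Fin using (Fin; _<?_) renaming (_<_ to _<ᶠ_)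
open import Data.Fin.Properties using (<-asym; ↑ˡ-injective)
open import Data.List using (List; []; _∷_; _++_; map; length; filter; allFin)
open import Data.List.Properties using (length-map; length-++; length-++-sucʳ; length-filter; length-tabulate)
open import Data.List.Membership.Propositional using (_∈_)
open import Data.List.Membership.Propositional.Properties
  using (∈-map⁻; ∈-∃++; ∈-++⁻; ∈-++⁺ˡ; ∈-++⁺ʳ; ∈-filter⁺; ∈-filter⁻; ∈-allFin)
open import Data.List.Relation.Binary.Subset.Propositional using (_⊆_)
open import Data.List.Relation.Unary.Any using (here; there)
open import Data.List.Relation.Unary.All as All using ()
open import Data.List.Relation.Unary.AllPairs using (_∷_)
open import Data.List.Relation.Unary.Unique.Propositional using (Unique)
import Data.List.Relation.Unary.Unique.Propositional.Properties as Unique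
open import Data.Product using (_×_; _,_; proj₁; proj₂)
open import Data.Sum using (inj₁; inj₂)
open import Data.Unit using (tt)
open import Data.Empty using (⊥; ⊥-elim)
open import Level using (0ℓ)
open import Relation.Nullary using (yes)
open import Relation.Unary using (Pred; Decidable)
open import Relation.Binary.PropositionalEquality using (_≡_; _≢_; refl; sym; trans; cong; subst)

module _ {A : Set} where

  ∈-delete : ∀ as {bs} {x z : A} → z ∈ as ++ x ∷ bs → z ≢ x → z ∈ as ++ bs
  ∈-delete as z∈ z≢x with ∈-++⁻ as z∈
  ... | inj₁ z∈as         = ∈-++⁺ˡ z∈as
  ... | inj₂ (here z≡x)   = ⊥-elim (z≢x z≡x)
  ... | inj₂ (there z∈bs) = ∈-++⁺ʳ as z∈bs

  unique-⊆-length : ∀ {xs ys : List A} → Unique xs → xs ⊆ ys → length xs ≤ length ys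
  unique-⊆-length {[]}     _              _     = z≤n
  unique-⊆-length {x ∷ xs} (x∉xs ∷ uxs) xs⊆ys with ∈-∃++ (xs⊆ys (here refl))
  ... | as , bs , refl =
    subst (suc (length xs) ≤_) (sym (length-++-sucʳ as x bs))
      (s≤s (unique-⊆-length uxs λ z∈xs →
        ∈-delete as (xs⊆ys (there z∈xs)) λ z≡x → All.lookup x∉xs z∈xs (sym z≡x)))

  disjoint-filters-length :
    ∀ {P Q R : Pred A 0ℓ} (P? : Decidable P) (Q? : Decidable Q) (R? : Decidable R) {xs} →
    Unique xs → (∀ {x} → P x → Q x → ⊥) → (∀ {x} → P x → R x) → (∀ {x} → Q x → R x) →
    length (filter P? xs) + length (filter Q? xs) ≤ length (filter R? xs)
  disjoint-filters-length P? Q? R? {xs} uxs P∩Q P⇒R Q⇒R = begin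
    length (filter P? xs) + length (filter Q? xs) ≡⟨ length-++ (filter P? xs) ⟨
    length (filter P? xs ++ filter Q? xs)         ≤⟨ unique-⊆-length unique included ⟩
    length (filter R? xs)                         ∎
    where
      open ≤-Reasoning
      unique : Unique (filter P? xs ++ filter Q? xs)
      unique = Unique.++⁺ (Unique.filter⁺ P? uxs) (Unique.filter⁺ Q? uxs)
        λ (v∈P , v∈Q) → P∩Q (proj₂ (∈-filter⁻ P? {xs = xs} v∈P)) (proj₂ (∈-filter⁻ Q? {xs = xs} v∈Q))
      included : filter P? xs ++ filter Q? xs ⊆ filter R? xs
      included v∈ with ∈-++⁻ (filter P? xs) v∈
      ... | inj₁ v∈P = let v∈xs , Pv = ∈-filter⁻ P? {xs = xs} v∈P in ∈-filter⁺ R? v∈xs (P⇒R Pv)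
      ... | inj₂ v∈Q = let v∈xs , Qv = ∈-filter⁻ Q? {xs = xs} v∈Q in ∈-filter⁺ R? v∈xs (Q⇒R Qv)

-- The points that f moves upward; for a pairing these are the smaller members of its pairs.
upward : ∀ {m} → (Fin m → Fin m) → List (Fin m)
upward {m} f = filter (λ x → x <? f x) (allFin m)

-- An involution of Fin m moves at most half of the points upward: f itself maps the
-- upward points injectively onto downward ones, and no point is both.
involution-upward-bound : ∀ {m} (f : Fin m → Fin m) → (∀ x → f (f x) ≡ x) →
                          2 * length (upward f) ≤ m
involution-upward-bound {m} f invol = begin
  2 * length (upward f)                        ≡⟨ cong (length (upward f) +_) (+-identityʳ _) ⟩
  length (upward f) + length (upward f)        ≤⟨ +-monoʳ-≤ (length (upward f)) up≤down ⟩
  length (upward f) + length downward          ≤⟨ disjoint-filters-length (λ x → x <? f x) (λ x → f x <? x)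
                                                    (λ _ → yes tt) (Unique.allFin⁺ m) <-asym _ _ ⟩
  length (filter (λ _ → yes tt) (allFin m))    ≤⟨ length-filter (λ _ → yes tt) (allFin m) ⟩
  length (allFin m)                            ≡⟨ length-tabulate (λ x → x) ⟩
  m                                            ∎
  where
    open ≤-Reasoning
    downward : List (Fin m)
    downward = filter (λ x → f x <? x) (allFin m)
    f-injective : ∀ {a b} → f a ≡ f b → a ≡ b
    f-injective {a} {b} fa≡fb = trans (sym (invol a)) (trans (cong f fa≡fb) (invol b))
    f-upward⊆downward : map f (upward f) ⊆ downward
    f-upward⊆downward y∈ =
      let x , x∈up , y≡fx = ∈-map⁻ f y∈
          x<fx = proj₂ (∈-filter⁻ (λ x → x <? f x) {xs = allFin m} x∈up)
      in ∈-filter⁺ (λ x → f x <? x) (∈-allFin _)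
           (subst (λ y → f y <ᶠ y) (sym y≡fx) (subst (_<ᶠ f x) (sym (invol x)) x<fx))
    up≤down : length (upward f) ≤ length downward
    up≤down = subst (_≤ length downward) (length-map f (upward f))
      (unique-⊆-length (Unique.map⁺ f-injective (Unique.filter⁺ _ (Unique.allFin⁺ m)))
                       f-upward⊆downward)

meets-at-most-once : ∀ {m R s} → SingleRoundRobin m R s → ∀ {x y : Fin m} → x ≢ y →
                     ∀ {r r'} → 1 ≤ r → r ≤ R → s r x ≡ y → 1 ≤ r' → r' ≤ R → s r' x ≡ y →
                     r ≡ r'
meets-at-most-once (_ , meet) x≢y 1≤r r≤R sr 1≤r' r'≤R sr'
  with _ , _ , _ , _ , only-round ← meet _ _ x≢y =
  trans (only-round _ 1≤r r≤R sr) (sym (only-round _ 1≤r' r'≤R sr'))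

-- Two distinct division-two rounds r, r' in which division one plays the same pairing
-- have at most n common fixtures in total: a pair with a common fixture in both would
-- meet twice in division two, so the counted pairs are disjoint sets of upward points
-- of the pairing, of which there are at most n.
shared-pairing-bound :
  (n : ℕ) (d1 : Schedule (2 * n)) (d2 : Schedule (2 * n + 2)) → DivisionTwo n d2 →
  (r r' : ℕ) → 1 ≤ r → r ≤ 2 * n + 1 → 1 ≤ r' → r' ≤ 2 * n + 1 → r ≢ r' →
  IsRound (d1 r) → (∀ x → d1 r' x ≡ d1 r x) →
  commonFixtures n d1 d2 r + commonFixtures n d1 d2 r' ≤ n
shared-pairing-bound n d1 d2 D2 r r' 1≤r r≤ 1≤r' r'≤ r≢r' (no-fixed-point , invol) same =
  ≤-trans (disjoint-filters-length _ _ (λ x → x <? f x) (Unique.allFin⁺ (2 * n))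
             not-in-both proj₁ (λ {x} (x<f'x , _) → subst (x <ᶠ_) (same x) x<f'x))
          (*-cancelˡ-≤ 2 (involution-upward-bound f invol))
  where
    f : Fin (2 * n) → Fin (2 * n)
    f = d1 r
    team : Fin (2 * n) → Fin (2 * n + 2)
    team = team₂ n
    not-in-both : ∀ {x} → (x <ᶠ f x) × d2 r (team x) ≡ team (f x) →
                  (x <ᶠ d1 r' x) × d2 r' (team x) ≡ team (d1 r' x) → ⊥
    not-in-both {x} (_ , meet-r) (_ , meet-r') =
      r≢r' (meets-at-most-once D2 distinct-teams 1≤r r≤ meet-r 1≤r' r'≤
              (subst (λ y → d2 r' (team x) ≡ team y) (same x) meet-r'))
      where
        distinct-teams : team x ≢ team (f x)
        distinct-teams eq = no-fixed-point x (sym (↑ˡ-injective 2 x (f x) eq))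

-- The theorem.  With p = 2n-1, division one plays the same pairing in rounds r and
-- r + p for r ∈ {1, 2}; as p ≥ 2 these are distinct division-two rounds, and
-- 1 + p = 2n, 2 + p = 2n + 1.
lemma3p2 : (n : ℕ) → 2 ≤ n →
    (d1 : Schedule (2 * n)) (d2 : Schedule (2 * n + 2)) →
    DivisionOne n d1 → DivisionTwo n d2 →
    (commonFixtures n d1 d2 1 + commonFixtures n d1 d2 (2 * n) ≤ n) ×
    (commonFixtures n d1 d2 2 + commonFixtures n d1 d2 (2 * n + 1) ≤ n)
lemma3p2 n 2≤n d1 d2 ((rounds₁ , _) , repeats) D2 =
    subst (λ k → common 1 + common k ≤ n) 1+p≡2n (repeated 1 (s≤s z≤n) (s≤s z≤n))
  , subst (λ k → common 2 + common k ≤ n) 2+p≡2n+1 (repeated 2 (s≤s z≤n) (s≤s (s≤s z≤n)))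
  where
    common : ℕ → ℕ
    common = commonFixtures n d1 d2
    p : ℕ
    p = 2 * n ∸ 1
    1≤2n : 1 ≤ 2 * n
    1≤2n = ≤-trans (s≤s z≤n) (*-monoʳ-≤ 2 2≤n)
    2≤p : 2 ≤ p
    2≤p = ≤-trans (s≤s (s≤s z≤n)) (∸-monoˡ-≤ 1 (*-monoʳ-≤ 2 2≤n))
    1+p≡2n : 1 + p ≡ 2 * n
    1+p≡2n = m+[n∸m]≡n 1≤2n
    2+p≡2n+1 : 2 + p ≡ 2 * n + 1
    2+p≡2n+1 = trans (cong suc 1+p≡2n) (+-comm 1 (2 * n))
    repeated : ∀ r → 1 ≤ r → r ≤ 2 → common r + common (r + p) ≤ n
    repeated r 1≤r r≤2 =
      shared-pairing-bound n d1 d2 D2 r (r + p) 1≤r (≤-trans (m≤m+n r p) r+p≤)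
        (≤-trans 1≤r (m≤m+n r p)) r+p≤ (<⇒≢ (m<m+n r (≤-trans (s≤s z≤n) 2≤p)))
        (rounds₁ r 1≤r r≤p) (repeats r 1≤r r≤p)
      where
        r≤p : r ≤ p
        r≤p = ≤-trans r≤2 2≤p
        r+p≤ : r + p ≤ 2 * n + 1
        r+p≤ = subst (r + p ≤_) 2+p≡2n+1 (+-monoˡ-≤ p r≤2)
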